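{- Let $k$ be an integer with $k\neq 0,\pm1,\pm2$, and let \begin{align*} a &=(k-1)^2 (k-2)^2 (k+2)^2(3k^6-2k^5-13k^4+8k^3+16k^2-16)^2 (5k^6-6k^5-27k^4+40k^3+32k^2-64k+16)^2, \\ b &=64 k^2 (k-1)^2 (k-2)^2 (k+2)^2 (k^3-k^2-3k+4)^2 (k^2-2)^2 (k^3-k^2-2k+4)^2 (2k^4-k^3-7k^2+4k+4)^2, \\ c &= k^2 (k-1)^2 (k^2-3)^2 (k^6-6k^5-3k^4+28k^3-8k^2-32k+16)^2 (4k^7-5k^6-26k^5+39k^4+48k^3-88k^2-16k+48)^2, \\ d &= (k+1)^2 (k^3-k^2-3k+4)^2 (k^6+2k^5-7k^4+8k^2-16k+16)^2 (4k^7-7k^6-22k^5+49k^4+20k^3-88k^2+32k+16)^2. \end{align*} Let \begin{align*} n_1 &= 16k^2 (k+1)^2 (k-2)^4 (k+2)^4 (k-1)^6 (k^2-3)^2 (k^3-k^2-2k+4)^2 (k^3-k^2-3k+4)^2 (2k^4-k^3-7k^2+4k+4)^2 \\ &\quad\times (3k^6-2k^5-13k^4+8k^3+16k^2-16)^2 (5k^6-6k^5-27k^4+40k^3+32k^2-64k+16)^2, \\ n_2 &= 4k^2 (k^2-2)^2 (k^3-k^2-3k+4)^2 (k^6+2k^5-7k^4+8k^2-16k+16)^2 (k^6-6k^5-3k^4+28k^3-8k^2-32k+16)^2 \\ &\quad\times (4k^7-5k^6-26k^5+39k^4+48k^3-88k^2-16k+48)^2 (4k^7-7k^6-22k^5+49k^4+20k^3-88k^2+32k+16)^2,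 \\ n_3 &= 0. \end{align*} Then $\{a,b,c,d\}$ is a $D(n_1)$-quadruple, a $D(n_2)$-quadruple and a $D(n_3)$-quadruple.
   Context: For an integer $n$ (the case $n=0$ being allowed), a set of four distinct nonzero integers $\{a,b,c,d\}$ is called a $D(n)$-quadruple if the product of any two distinct elements of the set, increased by $n$, is a perfect square of an integer. -}

module Defs where

open import Data.Nat using (ℕ)
open import Data.Integer using (ℤ; +_; _+_; _-_; _*_; _^_; -_)
open import Data.Product using (∃; _×_)
open import Relation.Binary.PropositionalEquality using (_≡_; _≢_)

IsSquare : ℤ → Set
IsSquare x = ∃ λ r → r * r ≡ x

IsDQuadruple : ℤ → ℤ → ℤ → ℤ → ℤ → Set
IsDQuadruple n a b c d =
  (a ≢ + 0 × b ≢ + 0 × c ≢ + 0 × d ≢ + 0) ×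
  (a ≢ b × a ≢ c × a ≢ d × b ≢ c × b ≢ d × c ≢ d) ×
  (IsSquare (a * b + n) × IsSquare (a * c + n) × IsSquare (a * d + n) ×
   IsSquare (b * c + n) × IsSquare (b * d + n) × IsSquare (c * d + n))

module _ (k : ℤ) where
  private
    c : ℕ → ℤ
    c m = + m

  f3a : ℤ
  f3a = k ^ 3 - k ^ 2 - c 3 * k + c 4
  f3b : ℤ
  f3b = k ^ 3 - k ^ 2 - c 2 * k + c 4
  f4 : ℤ
  f4 = c 2 * k ^ 4 - k ^ 3 - c 7 * k ^ 2 + c 4 * k + c 4
  f6a : ℤ
  f6a = c 3 * k ^ 6 - c 2 * k ^ 5 - c 13 * k ^ 4 + c 8 * k ^ 3 + c 16 * k ^ 2 - c 16
  f6b : ℤ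
  f6b = c 5 * k ^ 6 - c 6 * k ^ 5 - c 27 * k ^ 4 + c 40 * k ^ 3 + c 32 * k ^ 2 - c 64 * k + c 16
  f6c : ℤ
  f6c = k ^ 6 - c 6 * k ^ 5 - c 3 * k ^ 4 + c 28 * k ^ 3 - c 8 * k ^ 2 - c 32 * k + c 16
  f6d : ℤ
  f6d = k ^ 6 + c 2 * k ^ 5 - c 7 * k ^ 4 + c 8 * k ^ 2 - c 16 * k + c 16
  f7a : ℤ
  f7a = c 4 * k ^ 7 - c 5 * k ^ 6 - c 26 * k ^ 5 + c 39 * k ^ 4 + c 48 * k ^ 3 - c 88 * k ^ 2 - c 16 * k + c 48
  f7b : ℤ
  f7b = c 4 * k ^ 7 - c 7 * k ^ 6 - c 22 * k ^ 5 + c 49 * k ^ 4 + c 20 * k ^ 3 - c 88 * k ^ 2 + c 32 * k + c 16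

  qa : ℤ
  qa = (k - c 1) ^ 2 * (k - c 2) ^ 2 * (k + c 2) ^ 2 * f6a ^ 2 * f6b ^ 2

  qb : ℤ
  qb = c 64 * k ^ 2 * (k - c 1) ^ 2 * (k - c 2) ^ 2 * (k + c 2) ^ 2 * f3a ^ 2
       * (k ^ 2 - c 2) ^ 2 * f3b ^ 2 * f4 ^ 2

  qc : ℤ
  qc = k ^ 2 * (k - c 1) ^ 2 * (k ^ 2 - c 3) ^ 2 * f6c ^ 2 * f7a ^ 2

  qd : ℤ
  qd = (k + c 1) ^ 2 * f3a ^ 2 * f6d ^ 2 * f7b ^ 2

  n₁ : ℤ
  n₁ = c 16 * k ^ 2 * (k + c 1) ^ 2 * (k - c 2) ^ 4 * (k + c 2) ^ 4 * (k - c 1) ^ 6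
       * (k ^ 2 - c 3) ^ 2 * f3b ^ 2 * f3a ^ 2 * f4 ^ 2 * f6a ^ 2 * f6b ^ 2

  n₂ : ℤ
  n₂ = c 4 * k ^ 2 * (k ^ 2 - c 2) ^ 2 * f3a ^ 2 * f6d ^ 2 * f6c ^ 2 * f7a ^ 2 * f7b ^ 2

  n₃ : ℤ
  n₃ = + 0

-- With r_a = (k-1)(k-2)(k+2)f6a f6b, r_b = 8k(k-1)(k-2)(k+2)(k²-2)f3a f3b f4,
-- r_c = k(k-1)(k²-3)f6c f7a and r_d = (k+1)f3a f6d f7b we have a = r_a², …, d = r_d², which
-- gives the D(0) property at once; for n₁ and n₂ each xy + n is the square of an explicit
-- polynomial in k.  All these are polynomial identities, checked by expanding both sides.
-- Nonzeroness and distinctness reduce, via x² - y² = (x - y)(x + y), to the statement that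
-- r_x and r_x ± r_y never vanish for |k| > 2; by the rational root test an integer root
-- divides the lowest nonzero coefficient, and the finitely many candidates are checked.

module Submission where

open import Agda.Builtin.FromNat using (Number; fromNat)
open import Agda.Builtin.FromNeg using (Negative; fromNeg)
open import Data.Bool using (Bool; false; T)
open import Data.Integer using (ℤ; +_; -[1+_]; -_; 0ℤ; _+_; _-_; _*_; _^_; ∣_∣; _≟_)
import Data.Integer.Literals as ℤ
open import Data.Integer.Properties
open import Data.Integer.Tactic.RingSolver using (solve-∀)
open import Data.List using (List; []; _∷_; map; downFrom)
open import Data.List.Membership.Propositional.Properties using (∈-downFrom⁺)
open import Data.List.Relation.Unary.All as All using (All; []; _∷_)
open import Data.Nat as ℕ using (ℕ; zero; suc; _<_; _≤_; z≤n; s≤s)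
import Data.Nat.Literals as ℕ
open import Data.Nat.Divisibility using (_∣_; _∣?_; divides; ∣⇒≤)
import Data.Nat.Properties as ℕ
open import Data.Product using (_×_; _,_; proj₁; proj₂)
open import Data.Sum using (inj₁; inj₂; [_,_])
open import Data.Unit.Base using (tt)
open import Relation.Binary.PropositionalEquality
  using (_≡_; _≢_; refl; sym; trans; cong; subst; module ≡-Reasoning)
open import Relation.Nullary using (Dec; ¬?; contradiction; yes; no)
open import Relation.Nullary.Decidable using (True; isYes; toWitness; _×-dec_; _→-dec_)

open import Defs

instance
  ℕ-number : Number ℕ
  ℕ-number = ℕ.number
  ℤ-number : Number ℤ
  ℤ-number = ℤ.number
  ℤ-negative : Negative ℤ
  ℤ-negative = ℤ.negative

Poly : Set
Poly = List ℤ

eval : Poly → ℤ → ℤ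
eval []      k = 0ℤ
eval (c ∷ p) k = c + k * eval p k

infixl 6 _+ᴾ_
infixl 7 _*ᴾ_ _·ᴾ_
infixr 8 _^ᴾ_

_+ᴾ_ : Poly → Poly → Poly
[]      +ᴾ q       = q
(a ∷ p) +ᴾ []      = a ∷ p
(a ∷ p) +ᴾ (b ∷ q) = a + b ∷ p +ᴾ q

_·ᴾ_ : ℤ → Poly → Poly
c ·ᴾ p = map (c *_) p

_*ᴾ_ : Poly → Poly → Poly
[]      *ᴾ q = []
(a ∷ p) *ᴾ q = a ·ᴾ q +ᴾ (0ℤ ∷ p *ᴾ q)

_^ᴾ_ : Poly → ℕ → Poly
p ^ᴾ zero  = 1 ∷ []
p ^ᴾ suc n = p *ᴾ p ^ᴾ n

module _ (k : ℤ) where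

  eval-+ᴾ : ∀ p q → eval (p +ᴾ q) k ≡ eval p k + eval q k
  eval-+ᴾ []      q       = sym (+-identityˡ _)
  eval-+ᴾ (a ∷ p) []      = sym (+-identityʳ _)
  eval-+ᴾ (a ∷ p) (b ∷ q) rewrite eval-+ᴾ p q = regroup a b k (eval p k) (eval q k)
    where
    regroup : ∀ a b k x y → a + b + k * (x + y) ≡ a + k * x + (b + k * y)
    regroup = solve-∀

  eval-·ᴾ : ∀ c p → eval (c ·ᴾ p) k ≡ c * eval p k
  eval-·ᴾ c []      = sym (*-zeroʳ c)
  eval-·ᴾ c (a ∷ p) rewrite eval-·ᴾ c p = regroup c a k (eval p k)
    where
    regroup : ∀ c a k x → c * a + k * (c * x) ≡ c * (a + k * x)
    regroup = solve-∀

  eval-*ᴾ : ∀ p q → eval (p *ᴾ q) k ≡ eval p k * eval q k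
  eval-*ᴾ []      q = sym (*-zeroˡ (eval q k))
  eval-*ᴾ (a ∷ p) q
    rewrite eval-+ᴾ (a ·ᴾ q) (0ℤ ∷ p *ᴾ q) | eval-·ᴾ a q | eval-*ᴾ p q
    = regroup a k (eval p k) (eval q k)
    where
    regroup : ∀ a k x y → a * y + (0ℤ + k * (x * y)) ≡ (a + k * x) * y
    regroup = solve-∀

  eval-^ᴾ : ∀ p n → eval (p ^ᴾ n) k ≡ eval p k ^ n
  eval-^ᴾ p zero    = trans (cong (_+_ 1) (*-zeroʳ k)) (+-identityʳ 1)
  eval-^ᴾ p (suc n) rewrite eval-*ᴾ p (p ^ᴾ n) | eval-^ᴾ p n = refl

  eval-zeros : ∀ {p} → All (_≡ 0ℤ) p → eval p k ≡ 0ℤ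
  eval-zeros []           = refl
  eval-zeros (refl ∷ p≡0) rewrite eval-zeros p≡0 = cong (_+_ 0ℤ) (*-zeroʳ k)

infixl 6 _:+_ _:-_
infixl 7 _:*_
infixr 8 _:^_

data Expr : Set where
  var            : Expr
  con            : ℤ → Expr
  poly           : Poly → Expr
  _:+_ _:-_ _:*_ : Expr → Expr → Expr
  _:^_           : Expr → ℕ → Expr

⟦_⟧ : Expr → ℤ → ℤ
⟦ var    ⟧ k = k
⟦ con c  ⟧ k = c
⟦ poly p ⟧ k = eval p k
⟦ e :+ f ⟧ k = ⟦ e ⟧ k + ⟦ f ⟧ k
⟦ e :- f ⟧ k = ⟦ e ⟧ k - ⟦ f ⟧ k
⟦ e :* f ⟧ k = ⟦ e ⟧ k * ⟦ f ⟧ k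
⟦ e :^ n ⟧ k = ⟦ e ⟧ k ^ n

normalise : Expr → Poly
normalise var      = 0 ∷ 1 ∷ []
normalise (con c)  = c ∷ []
normalise (poly p) = p
normalise (e :+ f) = normalise e +ᴾ normalise f
normalise (e :- f) = normalise e +ᴾ -1 ·ᴾ normalise f
normalise (e :* f) = normalise e *ᴾ normalise f
normalise (e :^ n) = normalise e ^ᴾ n

eval-normalise : ∀ e k → eval (normalise e) k ≡ ⟦ e ⟧ k
eval-normalise var      k rewrite *-zeroʳ k | *-identityʳ k = +-identityˡ k
eval-normalise (con c)  k = trans (cong (_+_ c) (*-zeroʳ k)) (+-identityʳ c)
eval-normalise (poly p) k = refl
eval-normalise (e :+ f) k
  rewrite eval-+ᴾ k (normalise e) (normalise f) | eval-normalise e k | eval-normalise f k = refl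
eval-normalise (e :- f) k
  rewrite eval-+ᴾ k (normalise e) (-1 ·ᴾ normalise f) | eval-·ᴾ k -1 (normalise f)
        | eval-normalise e k | eval-normalise f k = cong (_+_ (⟦ e ⟧ k)) (-1*i≡-i (⟦ f ⟧ k))
eval-normalise (e :* f) k
  rewrite eval-*ᴾ k (normalise e) (normalise f) | eval-normalise e k | eval-normalise f k = refl
eval-normalise (e :^ n) k rewrite eval-^ᴾ k (normalise e) n | eval-normalise e k = refl

PolyIdentity : Expr → Expr → Set
PolyIdentity e f = True (All.all? (_≟ 0ℤ) (normalise (e :- f)))

polyIdentity-sound : ∀ e f {_ : PolyIdentity e f} k → ⟦ e ⟧ k ≡ ⟦ f ⟧ k
polyIdentity-sound e f {id} k = i-j≡0⇒i≡j _ _ (begin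
  ⟦ e :- f ⟧ k               ≡⟨ eval-normalise (e :- f) k ⟨
  eval (normalise (e :- f)) k ≡⟨ eval-zeros k (toWitness id) ⟩
  0ℤ                          ∎)
  where open ≡-Reasoning

RootsWithin : ℕ → Poly → Set
RootsWithin B p = ∀ k → eval p k ≡ 0ℤ → ∣ k ∣ ≤ B

root-divides-constant : ∀ c p k → eval (c ∷ p) k ≡ 0ℤ → ∣ k ∣ ∣ ∣ c ∣
root-divides-constant c p k root = divides ∣ eval p k ∣ (begin
  ∣ c ∣                     ≡⟨ cong ∣_∣ c≡-kq ⟩
  ∣ - (k * eval p k) ∣      ≡⟨ ∣-i∣≡∣i∣ (k * eval p k) ⟩
  ∣ k * eval p k ∣          ≡⟨ abs-* k (eval p k) ⟩
  ∣ k ∣ ℕ.* ∣ eval p k ∣    ≡⟨ ℕ.*-comm ∣ k ∣ _ ⟩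
  ∣ eval p k ∣ ℕ.* ∣ k ∣    ∎)
  where
  open ≡-Reasoning
  c≡-kq : c ≡ - (k * eval p k)
  c≡-kq = i-j≡0⇒i≡j c _ (trans (cong (_+_ c) (neg-involutive _)) root)

RejectedCandidate : ℕ → ℤ → Poly → ℕ → Set
RejectedCandidate B c p n =
  B < n → n ∣ ∣ c ∣ → eval (c ∷ p) (+ n) ≢ 0ℤ × eval (c ∷ p) (- + n) ≢ 0ℤ

rejectedCandidate? : ∀ B c p n → Dec (RejectedCandidate B c p n)
rejectedCandidate? B c p n = B ℕ.<? n →-dec n ∣? ∣ c ∣ →-dec
  ¬? (eval (c ∷ p) (+ n) ≟ 0ℤ) ×-dec ¬? (eval (c ∷ p) (- + n) ≟ 0ℤ)

DivisorTest : ℕ → ℤ → Poly → Set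
DivisorTest B c p = All (RejectedCandidate B c p) (downFrom (suc ∣ c ∣))

divisorTest? : ∀ B c p → Dec (DivisorTest B c p)
divisorTest? B c p = All.all? (rejectedCandidate? B c p) (downFrom (suc ∣ c ∣))

rejected-nonvanishing : ∀ {B c p} k → RejectedCandidate B c p ∣ k ∣ →
  B < ∣ k ∣ → ∣ k ∣ ∣ ∣ c ∣ → eval (c ∷ p) k ≢ 0ℤ
rejected-nonvanishing (+ n)    rejected B<n n∣c = proj₁ (rejected B<n n∣c)
rejected-nonvanishing -[1+ n ] rejected B<n n∣c = proj₂ (rejected B<n n∣c)

divisorTest-sound : ∀ B c p .{{_ : ℕ.NonZero ∣ c ∣}} → DivisorTest B c p → RootsWithin B (c ∷ p)
divisorTest-sound B c p test k root with ∣ k ∣ ℕ.≤? B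
... | yes ∣k∣≤B = ∣k∣≤B
... | no  ∣k∣≰B = contradiction root (rejected-nonvanishing {B} {c} {p} k rejected (ℕ.≰⇒> ∣k∣≰B) k∣c)
  where
  k∣c : ∣ k ∣ ∣ ∣ c ∣
  k∣c = root-divides-constant c p k root
  ∣k∣<1+∣c∣ : ∣ k ∣ < suc ∣ c ∣
  ∣k∣<1+∣c∣ = s≤s (∣⇒≤ k∣c)
  rejected : RejectedCandidate B c p ∣ k ∣
  rejected = All.lookup test (∈-downFrom⁺ ∣k∣<1+∣c∣)

rootsWithin? : ℕ → Poly → Bool
rootsWithin? B []           = false
rootsWithin? B (+ zero ∷ p) = rootsWithin? B p
rootsWithin? B (c ∷ p)      = isYes (divisorTest? B c p)

rootsWithin-sound : ∀ B p → T (rootsWithin? B p) → RootsWithin B p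
rootsWithin-sound B (+ zero ∷ p) ok k root
  with i*j≡0⇒i≡0∨j≡0 k (trans (sym (+-identityˡ _)) root)
... | inj₁ refl  = z≤n
... | inj₂ rootᵖ = rootsWithin-sound B p ok k rootᵖ
rootsWithin-sound B (c@(+ suc _) ∷ p)  ok = divisorTest-sound B c p (toWitness {a? = divisorTest? B c p} ok)
rootsWithin-sound B (c@(-[1+ _ ]) ∷ p) ok = divisorTest-sound B c p (toWitness {a? = divisorTest? B c p} ok)

nonvanishing : ∀ B e {_ : T (rootsWithin? B (normalise e))} k → B < ∣ k ∣ → ⟦ e ⟧ k ≢ 0ℤ
nonvanishing B e {ok} k B<∣k∣ root =
  ℕ.<⇒≱ B<∣k∣ (rootsWithin-sound B (normalise e) ok k (trans (eval-normalise e k) root))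

isSquare-by-identity : ∀ e r {_ : PolyIdentity (r :* r) e} k → IsSquare (⟦ e ⟧ k)
isSquare-by-identity e r {id} k = ⟦ r ⟧ k , polyIdentity-sound (r :* r) e {id} k

isSquare-* : ∀ {x y} → IsSquare x → IsSquare y → IsSquare (x * y)
isSquare-* (r , refl) (s , refl) = r * s , interchange r s
  where
  interchange : ∀ r s → r * s * (r * s) ≡ r * r * (s * s)
  interchange = solve-∀

nonzero-square : ∀ {x} (sq : IsSquare x) → proj₁ sq ≢ 0ℤ → x ≢ 0ℤ
nonzero-square (r , refl) r≢0 r*r≡0 = [ r≢0 , r≢0 ] (i*j≡0⇒i≡0∨j≡0 r r*r≡0)

distinct-squares : ∀ {x y} (sx : IsSquare x) (sy : IsSquare y) →
  proj₁ sx - proj₁ sy ≢ 0ℤ → proj₁ sx + proj₁ sy ≢ 0ℤ → x ≢ y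
distinct-squares (r , refl) (s , refl) r-s≢0 r+s≢0 r*r≡s*s =
  [ r-s≢0 , r+s≢0 ] (i*j≡0⇒i≡0∨j≡0 (r - s) (trans (difference-of-squares r s) (i≡j⇒i-j≡0 r*r≡s*s)))
  where
  difference-of-squares : ∀ r s → (r - s) * (r + s) ≡ r * r - s * s
  difference-of-squares = solve-∀

HasPropertyD : ℤ → ℤ → ℤ → ℤ → ℤ → Set
HasPropertyD n a b c d =
  IsSquare (a * b + n) × IsSquare (a * c + n) × IsSquare (a * d + n) ×
  IsSquare (b * c + n) × IsSquare (b * d + n) × IsSquare (c * d + n)

squares-hasPropertyD0 : ∀ {a b c d} → IsSquare a → IsSquare b → IsSquare c → IsSquare d →
  HasPropertyD 0ℤ a b c d
squares-hasPropertyD0 sa sb sc sd = sq sa sb , sq sa sc , sq sa sd , sq sb sc , sq sb sd , sq sc sd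
  where
  sq : ∀ {x y} → IsSquare x → IsSquare y → IsSquare (x * y + 0ℤ)
  sq sx sy = subst IsSquare (sym (+-identityʳ _)) (isSquare-* sx sy)

2<∣k∣ : ∀ {k} → k ≢ 0ℤ → k ≢ 1 → k ≢ -1 → k ≢ 2 → k ≢ -2 → 2 < ∣ k ∣
2<∣k∣ {+ 0}                 k≢0 _   _    _   _    = contradiction refl k≢0
2<∣k∣ {+ 1}                 _   k≢1 _    _   _    = contradiction refl k≢1
2<∣k∣ {+ 2}                 _   _   _    k≢2 _    = contradiction refl k≢2
2<∣k∣ {+ suc (suc (suc _))} _   _   _    _   _    = s≤s (s≤s (s≤s z≤n))
2<∣k∣ { -[1+ 0 ]}           _   _   k≢-1 _   _    = contradiction refl k≢-1
2<∣k∣ { -[1+ 1 ]}           _   _   _    _   k≢-2 = contradiction refl k≢-2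
2<∣k∣ { -[1+ suc (suc _) ]} _   _   _    _   _    = s≤s (s≤s (s≤s z≤n))

-- Syntactic copies of the definitions in Defs: ⟦ f3aᴱ ⟧ k reduces to f3a k, ⟦ qaᴱ ⟧ k to qa k, etc.
f3aᴱ f3bᴱ f4ᴱ f6aᴱ f6bᴱ f6cᴱ f6dᴱ f7aᴱ f7bᴱ : Expr
f3aᴱ = var :^ 3 :- var :^ 2 :- con 3 :* var :+ con 4
f3bᴱ = var :^ 3 :- var :^ 2 :- con 2 :* var :+ con 4
f4ᴱ  = con 2 :* var :^ 4 :- var :^ 3 :- con 7 :* var :^ 2 :+ con 4 :* var :+ con 4
f6aᴱ = con 3 :* var :^ 6 :- con 2 :* var :^ 5 :- con 13 :* var :^ 4 :+ con 8 :* var :^ 3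
       :+ con 16 :* var :^ 2 :- con 16
f6bᴱ = con 5 :* var :^ 6 :- con 6 :* var :^ 5 :- con 27 :* var :^ 4 :+ con 40 :* var :^ 3
       :+ con 32 :* var :^ 2 :- con 64 :* var :+ con 16
f6cᴱ = var :^ 6 :- con 6 :* var :^ 5 :- con 3 :* var :^ 4 :+ con 28 :* var :^ 3
       :- con 8 :* var :^ 2 :- con 32 :* var :+ con 16
f6dᴱ = var :^ 6 :+ con 2 :* var :^ 5 :- con 7 :* var :^ 4 :+ con 8 :* var :^ 2
       :- con 16 :* var :+ con 16
f7aᴱ = con 4 :* var :^ 7 :- con 5 :* var :^ 6 :- con 26 :* var :^ 5 :+ con 39 :* var :^ 4
       :+ con 48 :* var :^ 3 :- con 88 :* var :^ 2 :- con 16 :* var :+ con 48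
f7bᴱ = con 4 :* var :^ 7 :- con 7 :* var :^ 6 :- con 22 :* var :^ 5 :+ con 49 :* var :^ 4
       :+ con 20 :* var :^ 3 :- con 88 :* var :^ 2 :+ con 32 :* var :+ con 16

qaᴱ qbᴱ qcᴱ qdᴱ n₁ᴱ n₂ᴱ : Expr
qaᴱ = (var :- con 1) :^ 2 :* (var :- con 2) :^ 2 :* (var :+ con 2) :^ 2 :* f6aᴱ :^ 2 :* f6bᴱ :^ 2
qbᴱ = con 64 :* var :^ 2 :* (var :- con 1) :^ 2 :* (var :- con 2) :^ 2 :* (var :+ con 2) :^ 2
      :* f3aᴱ :^ 2 :* (var :^ 2 :- con 2) :^ 2 :* f3bᴱ :^ 2 :* f4ᴱ :^ 2
qcᴱ = var :^ 2 :* (var :- con 1) :^ 2 :* (var :^ 2 :- con 3) :^ 2 :* f6cᴱ :^ 2 :* f7aᴱ :^ 2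
qdᴱ = (var :+ con 1) :^ 2 :* f3aᴱ :^ 2 :* f6dᴱ :^ 2 :* f7bᴱ :^ 2
n₁ᴱ = con 16 :* var :^ 2 :* (var :+ con 1) :^ 2 :* (var :- con 2) :^ 4 :* (var :+ con 2) :^ 4
      :* (var :- con 1) :^ 6 :* (var :^ 2 :- con 3) :^ 2 :* f3bᴱ :^ 2 :* f3aᴱ :^ 2 :* f4ᴱ :^ 2
      :* f6aᴱ :^ 2 :* f6bᴱ :^ 2
n₂ᴱ = con 4 :* var :^ 2 :* (var :^ 2 :- con 2) :^ 2 :* f3aᴱ :^ 2 :* f6dᴱ :^ 2 :* f6cᴱ :^ 2
      :* f7aᴱ :^ 2 :* f7bᴱ :^ 2

√qa √qb √qc √qd : Expr
√qa = (var :- con 1) :* (var :- con 2) :* (var :+ con 2) :* f6aᴱ :* f6bᴱ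
√qb = con 8 :* var :* (var :- con 1) :* (var :- con 2) :* (var :+ con 2) :* (var :^ 2 :- con 2)
      :* f3aᴱ :* f3bᴱ :* f4ᴱ
√qc = var :* (var :- con 1) :* (var :^ 2 :- con 3) :* f6cᴱ :* f7aᴱ
√qd = (var :+ con 1) :* f3aᴱ :* f6dᴱ :* f7bᴱ

-- Cofactors of the square roots of xy + n, indexed by degree.  Each serves one pair for n₁
-- and the complementary pair for n₂.
h₄ h₁₄ h₁₄′ h₁₆ h₁₈ h₂₆ : Expr
h₄   = var :^ 4 :- con 4 :* var :^ 2 :+ con 5
h₁₄  = poly (256 ∷ 256 ∷ -640 ∷ -2624 ∷ 5216 ∷ -400 ∷ -5000 ∷ 2756 ∷ 1537 ∷ -1584 ∷ -26 ∷ 352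
             ∷ -63 ∷ -28 ∷ 8 ∷ [])
h₁₄′ = poly (1280 ∷ -1280 ∷ -3712 ∷ 4416 ∷ 4064 ∷ -6320 ∷ -1480 ∷ 4364 ∷ -283 ∷ -1560 ∷ 350
             ∷ 280 ∷ -91 ∷ -20 ∷ 8 ∷ [])
h₁₆  = poly (1024 ∷ -4096 ∷ 4352 ∷ 8192 ∷ -18304 ∷ -1024 ∷ 23008 ∷ -9536 ∷ -12396 ∷ 9328
             ∷ 2517 ∷ -3764 ∷ 211 ∷ 712 ∷ -157 ∷ -52 ∷ 17 ∷ [])
h₁₈  = poly (5120 ∷ -10240 ∷ 12544 ∷ -37376 ∷ 45440 ∷ 34048 ∷ -97824 ∷ 22656 ∷ 68804
             ∷ -41096 ∷ -21499 ∷ 22634 ∷ 1718 ∷ -6314 ∷ 758 ∷ 910 ∷ -214 ∷ -54 ∷ 17 ∷ [])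
h₂₆  = poly (327680 ∷ -1310720 ∷ 196608 ∷ 6225920 ∷ -6832128 ∷ -12632064 ∷ 26644480
             ∷ 1224704 ∷ -35746304 ∷ 18095104 ∷ 22186240 ∷ -21785344 ∷ -5493312 ∷ 12620736
             ∷ -1157136 ∷ -4262768 ∷ 1312517 ∷ 834568 ∷ -446564 ∷ -71640 ∷ 79966 ∷ -4888
             ∷ -7108 ∷ 1672 ∷ 133 ∷ -112 ∷ 16 ∷ [])

√ab+n₁ √ac+n₁ √ad+n₁ √bc+n₁ √bd+n₁ √cd+n₁ : Expr
√ab+n₁ = con 4 :* var :* (var :- con 1) :^ 2 :* (var :- con 2) :^ 2 :* (var :+ con 2) :^ 2
         :* f3aᴱ :* f3bᴱ :* f4ᴱ :* f6aᴱ :* f6bᴱ :* h₄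
√ac+n₁ = var :* (var :- con 1) :^ 2 :* (var :- con 2) :* (var :+ con 2) :* (var :^ 2 :- con 3)
         :* f6aᴱ :* f6bᴱ :* h₁₄′
√ad+n₁ = (var :- con 1) :* (var :+ con 1) :* (var :- con 2) :* (var :+ con 2)
         :* f3aᴱ :* f6aᴱ :* f6bᴱ :* h₁₄
√bc+n₁ = con 4 :* var :* (var :- con 1) :^ 2 :* (var :- con 2) :* (var :+ con 2) :* (var :^ 2 :- con 3)
         :* f3aᴱ :* f3bᴱ :* f4ᴱ :* h₁₆
√bd+n₁ = con 4 :* var :* (var :- con 1) :* (var :+ con 1) :* (var :- con 2) :* (var :+ con 2)
         :* f3aᴱ :* f3bᴱ :* f4ᴱ :* h₁₈
√cd+n₁ = var :* (var :- con 1) :* (var :+ con 1) :* (var :^ 2 :- con 3) :* f3aᴱ :* h₂₆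

√ab+n₂ √ac+n₂ √ad+n₂ √bc+n₂ √bd+n₂ √cd+n₂ : Expr
√ab+n₂ = con 2 :* var :* (var :^ 2 :- con 2) :* f3aᴱ :* h₂₆
√ac+n₂ = var :* f6cᴱ :* f7aᴱ :* h₁₈
√ad+n₂ = f3aᴱ :* f6dᴱ :* f7bᴱ :* h₁₆
√bc+n₂ = con 2 :* var :* (var :^ 2 :- con 2) :* f3aᴱ :* f6cᴱ :* f7aᴱ :* h₁₄
√bd+n₂ = con 2 :* var :* (var :^ 2 :- con 2) :* f3aᴱ :* f6dᴱ :* f7bᴱ :* h₁₄′
√cd+n₂ = var :* f3aᴱ :* f6cᴱ :* f6dᴱ :* f7aᴱ :* f7bᴱ :* h₄

qa-square : ∀ k → IsSquare (qa k)
qa-square = isSquare-by-identity qaᴱ √qa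

qb-square : ∀ k → IsSquare (qb k)
qb-square = isSquare-by-identity qbᴱ √qb

qc-square : ∀ k → IsSquare (qc k)
qc-square = isSquare-by-identity qcᴱ √qc

qd-square : ∀ k → IsSquare (qd k)
qd-square = isSquare-by-identity qdᴱ √qd

quadruple-nonzero : ∀ k → 2 < ∣ k ∣ → qa k ≢ 0ℤ × qb k ≢ 0ℤ × qc k ≢ 0ℤ × qd k ≢ 0ℤ
quadruple-nonzero k 2<∣k∣ =
  nonzero-square (qa-square k) (nonvanishing 2 √qa k 2<∣k∣) ,
  nonzero-square (qb-square k) (nonvanishing 2 √qb k 2<∣k∣) ,
  nonzero-square (qc-square k) (nonvanishing 2 √qc k 2<∣k∣) ,
  nonzero-square (qd-square k) (nonvanishing 2 √qd k 2<∣k∣)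

quadruple-distinct : ∀ k → 2 < ∣ k ∣ →
  qa k ≢ qb k × qa k ≢ qc k × qa k ≢ qd k × qb k ≢ qc k × qb k ≢ qd k × qc k ≢ qd k
quadruple-distinct k 2<∣k∣ =
  distinct-squares (qa-square k) (qb-square k) (≢0 (√qa :- √qb)) (≢0 (√qa :+ √qb)) ,
  distinct-squares (qa-square k) (qc-square k) (≢0 (√qa :- √qc)) (≢0 (√qa :+ √qc)) ,
  distinct-squares (qa-square k) (qd-square k) (≢0 (√qa :- √qd)) (≢0 (√qa :+ √qd)) ,
  distinct-squares (qb-square k) (qc-square k) (≢0 (√qb :- √qc)) (≢0 (√qb :+ √qc)) ,
  distinct-squares (qb-square k) (qd-square k) (≢0 (√qb :- √qd)) (≢0 (√qb :+ √qd)) ,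
  distinct-squares (qc-square k) (qd-square k) (≢0 (√qc :- √qd)) (≢0 (√qc :+ √qd))
  where
  ≢0 : ∀ e {_ : T (rootsWithin? 2 (normalise e))} → ⟦ e ⟧ k ≢ 0ℤ
  ≢0 e {ok} = nonvanishing 2 e {ok} k 2<∣k∣

hasPropertyD-n₁ : ∀ k → HasPropertyD (n₁ k) (qa k) (qb k) (qc k) (qd k)
hasPropertyD-n₁ k =
  isSquare-by-identity (qaᴱ :* qbᴱ :+ n₁ᴱ) √ab+n₁ k ,
  isSquare-by-identity (qaᴱ :* qcᴱ :+ n₁ᴱ) √ac+n₁ k ,
  isSquare-by-identity (qaᴱ :* qdᴱ :+ n₁ᴱ) √ad+n₁ k ,
  isSquare-by-identity (qbᴱ :* qcᴱ :+ n₁ᴱ) √bc+n₁ k ,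
  isSquare-by-identity (qbᴱ :* qdᴱ :+ n₁ᴱ) √bd+n₁ k ,
  isSquare-by-identity (qcᴱ :* qdᴱ :+ n₁ᴱ) √cd+n₁ k

hasPropertyD-n₂ : ∀ k → HasPropertyD (n₂ k) (qa k) (qb k) (qc k) (qd k)
hasPropertyD-n₂ k =
  isSquare-by-identity (qaᴱ :* qbᴱ :+ n₂ᴱ) √ab+n₂ k ,
  isSquare-by-identity (qaᴱ :* qcᴱ :+ n₂ᴱ) √ac+n₂ k ,
  isSquare-by-identity (qaᴱ :* qdᴱ :+ n₂ᴱ) √ad+n₂ k ,
  isSquare-by-identity (qbᴱ :* qcᴱ :+ n₂ᴱ) √bc+n₂ k ,
  isSquare-by-identity (qbᴱ :* qdᴱ :+ n₂ᴱ) √bd+n₂ k ,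
  isSquare-by-identity (qcᴱ :* qdᴱ :+ n₂ᴱ) √cd+n₂ k

proposition1 : (k : ℤ) → k ≢ + 0 → k ≢ + 1 → k ≢ - + 1 → k ≢ + 2 → k ≢ - + 2 →
    IsDQuadruple (n₁ k) (qa k) (qb k) (qc k) (qd k) ×
    IsDQuadruple (n₂ k) (qa k) (qb k) (qc k) (qd k) ×
    IsDQuadruple (n₃ k) (qa k) (qb k) (qc k) (qd k)
proposition1 k k≢0 k≢1 k≢-1 k≢2 k≢-2 =
  (quadruple-nonzero k large , quadruple-distinct k large , hasPropertyD-n₁ k) ,
  (quadruple-nonzero k large , quadruple-distinct k large , hasPropertyD-n₂ k) ,
  (quadruple-nonzero k large , quadruple-distinct k large ,
   squares-hasPropertyD0 (qa-square k) (qb-square k) (qc-square k) (qd-square k))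
  where
  large : 2 < ∣ k ∣
  large = 2<∣k∣ k≢0 k≢1 k≢-1 k≢2 k≢-2
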